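{- Let $m_1,m_2\in\mathcal{M}_N$ be Knuth-like equivalent matchings and let $1\le i\le N+1$. Then $\mathrm{ins}_i(m_1)$ and $\mathrm{ins}_i(m_2)$ are Knuth-like equivalent.
   Context: A matching on a finite set $S\subseteq\mathbb{N}$ is a partition of $S$ into blocks of size 1 (unmatched vertex $(i)$) or 2 (chord $(i,j)$); $\mathcal{M}_N$ is the set of matchings on $[N]$. For $m\in\mathcal{M}_N$ and $1\le i\le N+1$, let $f_i(j)=j$ for $j<i$ and $f_i(j)=j+2$ for $j\ge i$; $\mathrm{ins}_i(m)\in\mathcal{M}_{N+2}$ consists of the chords $(f_i(j_1),f_i(j_2))$ for chords $(j_1,j_2)$ of $m$, the chord $(i,i+1)$, and unmatched vertices $(f_i(j))$ for unmatched vertices $(j)$ of $m$. Elementary Knuth-like transformations: (a) replace $(i,i+1),(i+2)$ by $(i),(i+1,i+2)$ or vice versa; (b) replace chords $(i,i+1),(i+2,j)$ (any $j$) by $(i,j),(i+1,i+2)$ or vice versa. Knuth-like equivalence is the equivalence relation generated by them. -}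

module Defs where

open import Data.Nat using (ℕ; suc; _+_; _∸_; _≤_; _<ᵇ_; _≡ᵇ_)
open import Data.Bool using (if_then_else_)
open import Data.Product using (_×_; Σ)
open import Relation.Binary.PropositionalEquality using (_≡_; _≢_)

-- A matching on [N] = {1,…,N} is encoded by its partner function p : ℕ → ℕ:
-- p j is the partner of j if j lies on a chord, and p j = j if (j) is an
-- unmatched vertex.  Only the values on [N] are meaningful.
IsMatching : ℕ → (ℕ → ℕ) → Set
IsMatching N p = ∀ j → 1 ≤ j → j ≤ N → (1 ≤ p j) × (p j ≤ N) × (p (p j) ≡ j)

Agree : ℕ → (ℕ → ℕ) → (ℕ → ℕ) → Set
Agree N p q = ∀ j → 1 ≤ j → j ≤ N → p j ≡ q j

AgreeOutside2 : ℕ → ℕ → (ℕ → ℕ) → (ℕ → ℕ) → Set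
AgreeOutside2 N i p q =
  ∀ k → 1 ≤ k → k ≤ N → k ≢ i → k ≢ suc i → k ≢ suc (suc i) → p k ≡ q k

AgreeOutside3 : ℕ → ℕ → ℕ → (ℕ → ℕ) → (ℕ → ℕ) → Set
AgreeOutside3 N i j p q =
  ∀ k → 1 ≤ k → k ≤ N → k ≢ i → k ≢ suc i → k ≢ suc (suc i) → k ≢ j → p k ≡ q k

-- Elementary Knuth-like transformations (one direction; the equivalence
-- closure below supplies "vice versa").
data Elem (N : ℕ) (p q : ℕ → ℕ) : Set where
  -- (a): (i,i+1),(i+2)  ↦  (i),(i+1,i+2)
  moveA : (i : ℕ) → 1 ≤ i → suc (suc i) ≤ N →
          p i ≡ suc i → p (suc i) ≡ i → p (suc (suc i)) ≡ suc (suc i) →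
          q i ≡ i → q (suc i) ≡ suc (suc i) → q (suc (suc i)) ≡ suc i →
          AgreeOutside2 N i p q → Elem N p q
  -- (b): (i,i+1),(i+2,j)  ↦  (i,j),(i+1,i+2)
  moveB : (i j : ℕ) → 1 ≤ i → suc (suc i) ≤ N → 1 ≤ j → j ≤ N →
          j ≢ i → j ≢ suc i → j ≢ suc (suc i) →
          p i ≡ suc i → p (suc i) ≡ i → p (suc (suc i)) ≡ j → p j ≡ suc (suc i) →
          q i ≡ j → q j ≡ i → q (suc i) ≡ suc (suc i) → q (suc (suc i)) ≡ suc i →
          AgreeOutside3 N i j p q → Elem N p q

data KnuthEq (N : ℕ) : (ℕ → ℕ) → (ℕ → ℕ) → Set where
  same  : ∀ {p q} → IsMatching N p → IsMatching N q → Agree N p q → KnuthEq N p q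
  step  : ∀ {p q} → IsMatching N p → IsMatching N q → Elem N p q → KnuthEq N p q
  symm  : ∀ {p q} → KnuthEq N p q → KnuthEq N q p
  trans : ∀ {p q r} → KnuthEq N p q → KnuthEq N q r → KnuthEq N p r

shift : ℕ → ℕ → ℕ
shift i j = if j <ᵇ i then j else j + 2

ins : ℕ → (ℕ → ℕ) → (ℕ → ℕ)
ins i p k =
  if k <ᵇ i then shift i (p k)
  else if k ≡ᵇ i then suc i
  else if k ≡ᵇ suc i then i
  else shift i (p (k ∸ 2))

-- An elementary transformation only moves one chord (a, a+1) to (a+1, a+2): both
-- matchings are insertions of a short chord at adjacent positions into a common
-- matching r.  Moving an inserted short chord by one position is itself an
-- elementary transformation, and insertions commute up to relabelling, so
--   ins i (ins a r) ~ ins a (ins a r) = ins (a+2) (ins a r) ~ ins (a+3) (ins a r)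
--                   = ins a (ins (a+1) r) ~ ins i (ins (a+1) r).
module Submission where

open import Defs
open import Data.Nat using (ℕ; zero; suc; _+_; _∸_; _≤_; _<_; z≤n; s≤s; _<?_; _≟_; _<ᵇ_; _≡ᵇ_)
open import Data.Nat.Properties
open import Data.Bool using (true; false; if_then_else_)
open import Data.Product using (_×_; _,_; proj₂; ∃-syntax)
open import Function using (_∘_)
open import Data.Sum using (inj₁; inj₂)
open import Data.Empty using (⊥-elim)
open import Relation.Nullary using (yes; no)
open import Relation.Binary.PropositionalEquality renaming (trans to ≡-trans)

<ᵇ-true : ∀ {m n} → m < n → (m <ᵇ n) ≡ true
<ᵇ-true {zero}  {suc n} _         = refl
<ᵇ-true {suc m} {suc n} (s≤s m<n) = <ᵇ-true m<n

<ᵇ-false : ∀ {m n} → n ≤ m → (m <ᵇ n) ≡ false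
<ᵇ-false {m}     {zero}  _         = refl
<ᵇ-false {suc m} {suc n} (s≤s n≤m) = <ᵇ-false n≤m

≡ᵇ-refl : ∀ m → (m ≡ᵇ m) ≡ true
≡ᵇ-refl zero    = refl
≡ᵇ-refl (suc m) = ≡ᵇ-refl m

≡ᵇ-false : ∀ {m n} → m ≢ n → (m ≡ᵇ n) ≡ false
≡ᵇ-false {zero}  {zero}  m≢n = ⊥-elim (m≢n refl)
≡ᵇ-false {zero}  {suc n} _   = refl
≡ᵇ-false {suc m} {zero}  _   = refl
≡ᵇ-false {suc m} {suc n} m≢n = ≡ᵇ-false (m≢n ∘ cong suc)

m≤n⇒m≤2+n : ∀ {m n} → m ≤ n → m ≤ suc (suc n)
m≤n⇒m≤2+n m≤n = m≤n⇒m≤1+n (m≤n⇒m≤1+n m≤n)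

n+2≡2+n : ∀ n → n + 2 ≡ suc (suc n)
n+2≡2+n n = +-comm n 2

m<n+1⇒m≤n : ∀ {m n} → m < n + 1 → m ≤ n
m<n+1⇒m≤n {m} {n} m<n+1 = m<1+n⇒m≤n (subst (m <_) (+-comm n 1) m<n+1)

2+m≤n+2⇒m≤n : ∀ {m n} → suc (suc m) ≤ n + 2 → m ≤ n
2+m≤n+2⇒m≤n {m} {n} h = ≤-pred (≤-pred (subst (suc (suc m) ≤_) (n+2≡2+n n) h))

m≤n⇒2+m≤n+2 : ∀ {m n} → m ≤ n → suc (suc m) ≤ n + 2
m≤n⇒2+m≤n+2 {m} {n} m≤n = subst (suc (suc m) ≤_) (sym (n+2≡2+n n)) (s≤s (s≤s m≤n))

m≤n+1⇒1+m≤n+2 : ∀ {m n} → m ≤ n + 1 → suc m ≤ n + 2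
m≤n+1⇒1+m≤n+2 {m} {n} m≤n+1 = subst (suc m ≤_) (sym (+-suc n 1)) (s≤s m≤n+1)

m≤n⇒1+m≤n+1 : ∀ {m n} → m ≤ n → suc m ≤ n + 1
m≤n⇒1+m≤n+1 {m} {n} m≤n = subst (suc m ≤_) (sym (+-comm n 1)) (s≤s m≤n)

m≤n+1⇒m≤n+2 : ∀ {m n} → m ≤ n + 1 → m ≤ n + 2
m≤n+1⇒m≤n+2 {m} {n} m≤n+1 = ≤-trans m≤n+1 (+-monoʳ-≤ n (s≤s z≤n))

-- Position of k relative to the two slots j, j+1 that an insertion at j occupies.
data Around (j : ℕ) : ℕ → Set where
  below  : ∀ {k} → k < j → Around j k
  at     : Around j j
  next   : Around j (suc j)
  beyond : ∀ {m} → j ≤ m → Around j (suc (suc m))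

around-suc : ∀ {j k} → Around j k → Around (suc j) (suc k)
around-suc (below k<j)  = below (s≤s k<j)
around-suc at           = at
around-suc next         = next
around-suc (beyond j≤m) = beyond (s≤s j≤m)

around : ∀ j k → Around j k
around zero    zero          = at
around zero    (suc zero)    = next
around zero    (suc (suc m)) = beyond z≤n
around (suc j) zero          = below (s≤s z≤n)
around (suc j) (suc k)       = around-suc (around j k)

shift-< : ∀ {i x} → x < i → shift i x ≡ x
shift-< {i} {x} x<i rewrite <ᵇ-true x<i = refl

shift-≥ : ∀ {i x} → i ≤ x → shift i x ≡ suc (suc x)
shift-≥ {i} {x} i≤x rewrite <ᵇ-false {x} {i} i≤x = n+2≡2+n x

shift≢ : ∀ i x → shift i x ≢ i
shift≢ i x with x <? i
... | yes x<i rewrite shift-< x<i = <⇒≢ x<i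
... | no  x≮i rewrite shift-≥ (≮⇒≥ x≮i) = λ e → <⇒≢ (s≤s (m≤n⇒m≤1+n (≮⇒≥ x≮i))) (sym e)

shift≢suc : ∀ i x → shift i x ≢ suc i
shift≢suc i x with x <? i
... | yes x<i rewrite shift-< x<i = <⇒≢ (m≤n⇒m≤1+n x<i)
... | no  x≮i rewrite shift-≥ (≮⇒≥ x≮i) = λ e → <⇒≢ (s≤s (s≤s (≮⇒≥ x≮i))) (sym e)

shift≢2+ : ∀ {i x} → x ≢ i → shift i x ≢ suc (suc i)
shift≢2+ {i} {x} x≢i with x <? i
... | yes x<i rewrite shift-< x<i = <⇒≢ (m≤n⇒m≤2+n x<i)
... | no  x≮i rewrite shift-≥ (≮⇒≥ x≮i) = λ e → x≢i (suc-injective (suc-injective e))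

shift-suc : ∀ {i x} → x ≢ i → shift i x ≡ shift (suc i) x
shift-suc {i} {x} x≢i with x <? i
... | yes x<i rewrite shift-< x<i | shift-< (m≤n⇒m≤1+n x<i) = refl
... | no  x≮i rewrite shift-≥ (≮⇒≥ x≮i) | shift-≥ (≤∧≢⇒< (≮⇒≥ x≮i) (x≢i ∘ sym)) = refl

shift-suc≢ : ∀ {a x} → x ≢ a → shift (suc a) x ≢ a
shift-suc≢ {a} {x} x≢a with x <? suc a
... | yes x<1+a rewrite shift-< x<1+a = x≢a
... | no  x≮1+a rewrite shift-≥ (≮⇒≥ x≮1+a) =
  λ e → <⇒≢ (≤-trans (n<1+n a) (m≤n⇒m≤2+n (≮⇒≥ x≮1+a))) (sym e)

shift-∈ : ∀ {N i x} → i ≤ N + 1 → 1 ≤ x → x ≤ N → (1 ≤ shift i x) × (shift i x ≤ N + 2)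
shift-∈ {N} {i} {x} i≤N+1 1≤x x≤N with x <? i
... | yes x<i rewrite shift-< x<i = 1≤x , m≤n⇒m≤n+o 2 x≤N
... | no  x≮i rewrite shift-≥ (≮⇒≥ x≮i) = s≤s z≤n , m≤n⇒2+m≤n+2 x≤N

shift-shift : ∀ {j i} x → j ≤ i → shift j (shift i x) ≡ shift (suc (suc i)) (shift j x)
shift-shift {j} {i} x j≤i with x <? j
... | yes x<j rewrite shift-< (<-≤-trans x<j j≤i) | shift-< x<j
                    | shift-< (m≤n⇒m≤2+n (<-≤-trans x<j j≤i)) = refl
... | no x≮j with x <? i
...   | yes x<i rewrite shift-< x<i | shift-≥ (≮⇒≥ x≮j) | shift-< (s≤s (s≤s x<i)) = refl
...   | no x≮i rewrite shift-≥ (≮⇒≥ x≮i) | shift-≥ (≮⇒≥ x≮j) | shift-≥ (m≤n⇒m≤2+n (≮⇒≥ x≮j))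
                     | shift-≥ (s≤s (s≤s (≮⇒≥ x≮i))) = refl

ins-< : ∀ {i k} p → k < i → ins i p k ≡ shift i (p k)
ins-< p k<i rewrite <ᵇ-true k<i = refl

ins-new₁ : ∀ i p → ins i p i ≡ suc i
ins-new₁ i p rewrite <ᵇ-false {i} {i} ≤-refl | ≡ᵇ-refl i = refl

ins-new₂ : ∀ i p → ins i p (suc i) ≡ i
ins-new₂ i p rewrite <ᵇ-false {suc i} {i} (n≤1+n i) | ≡ᵇ-false {suc i} {i} 1+n≢n | ≡ᵇ-refl i = refl

ins-≥ : ∀ {i m} p → i ≤ m → ins i p (suc (suc m)) ≡ shift i (p m)
ins-≥ {i} {m} p i≤m
  rewrite <ᵇ-false {suc (suc m)} {i} (m≤n⇒m≤2+n i≤m)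
        | ≡ᵇ-false {suc (suc m)} {i} (λ e → <⇒≱ (s≤s (n≤1+n m)) (subst (_≤ m) (sym e) i≤m))
        | ≡ᵇ-false {suc (suc m)} {suc i} (λ e → <⇒≱ (n<1+n m) (subst (_≤ m) (sym (suc-injective e)) i≤m))
  = refl

ins-shift : ∀ i p x → ins i p (shift i x) ≡ shift i (p x)
ins-shift i p x with x <? i
... | yes x<i rewrite shift-< x<i = ins-< p x<i
... | no  x≮i rewrite shift-≥ (≮⇒≥ x≮i) = ins-≥ p (≮⇒≥ x≮i)

ins-ins : ∀ {j i} s k → j ≤ i → ins j (ins i s) k ≡ ins (suc (suc i)) (ins j s) k
ins-ins {j} {i} s k j≤i with around j k
... | below k<j
  rewrite ins-< (ins i s) k<j | ins-< s (<-≤-trans k<j j≤i)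
        | ins-< (ins j s) (m≤n⇒m≤2+n (<-≤-trans k<j j≤i)) | ins-< s k<j = shift-shift (s k) j≤i
... | at
  rewrite ins-new₁ j (ins i s) | ins-< (ins j s) (s≤s (m≤n⇒m≤1+n j≤i))
        | ins-new₁ j s | shift-< (s≤s (s≤s j≤i)) = refl
... | next
  rewrite ins-new₂ j (ins i s) | ins-< (ins j s) (s≤s (s≤s j≤i))
        | ins-new₂ j s | shift-< (s≤s (m≤n⇒m≤1+n j≤i)) = refl
... | beyond {m} j≤m rewrite ins-≥ (ins i s) j≤m with around i m
...   | below m<i
  rewrite ins-< s m<i | ins-< (ins j s) (s≤s (s≤s m<i)) | ins-≥ s j≤m = shift-shift (s m) j≤i
...   | at
  rewrite ins-new₁ i s | shift-≥ (m≤n⇒m≤1+n j≤i) | ins-new₁ (suc (suc i)) (ins j s) = refl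
...   | next
  rewrite ins-new₂ i s | shift-≥ j≤i | ins-new₂ (suc (suc i)) (ins j s) = refl
...   | beyond {n} i≤n
  rewrite ins-≥ s i≤n | ins-≥ (ins j s) (s≤s (s≤s i≤n))
        | ins-≥ s (≤-trans j≤i i≤n) = shift-shift (s n) j≤i

data InsView (N i : ℕ) : ℕ → Set where
  new₁ : InsView N i i
  new₂ : InsView N i (suc i)
  old  : ∀ x → 1 ≤ x → x ≤ N → InsView N i (shift i x)

insView : ∀ {N i k} → 1 ≤ i → i ≤ N + 1 → 1 ≤ k → k ≤ N + 2 → InsView N i k
insView {N} {i} {k} 1≤i i≤N+1 1≤k k≤N+2 with around i k
... | below k<i = subst (InsView N i) (shift-< k<i) (old k 1≤k (m<n+1⇒m≤n (<-≤-trans k<i i≤N+1)))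
... | at = new₁
... | next = new₂
... | beyond {m} i≤m =
  subst (InsView N i) (shift-≥ i≤m) (old m (≤-trans 1≤i i≤m) (2+m≤n+2⇒m≤n k≤N+2))

ins-isMatching : ∀ {N p i} → IsMatching N p → 1 ≤ i → i ≤ N + 1 → IsMatching (N + 2) (ins i p)
ins-isMatching {N} {p} {i} mp 1≤i i≤N+1 k 1≤k k≤N+2 with insView 1≤i i≤N+1 1≤k k≤N+2
... | new₁ rewrite ins-new₁ i p | ins-new₂ i p = s≤s z≤n , m≤n+1⇒1+m≤n+2 i≤N+1 , refl
... | new₂ rewrite ins-new₂ i p | ins-new₁ i p = 1≤i , m≤n+1⇒m≤n+2 i≤N+1 , refl
... | old x 1≤x x≤N rewrite ins-shift i p x =
  let (1≤px , px≤N , ppx≡x) = mp x 1≤x x≤N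
      (1≤y , y≤N+2) = shift-∈ i≤N+1 1≤px px≤N
  in 1≤y , y≤N+2 , ≡-trans (ins-shift i p (p x)) (cong (shift i) ppx≡x)

ins-agree : ∀ {N p q i} → 1 ≤ i → i ≤ N + 1 → Agree N p q → Agree (N + 2) (ins i p) (ins i q)
ins-agree {N} {p} {q} {i} 1≤i i≤N+1 p≈q k 1≤k k≤N+2 with insView 1≤i i≤N+1 1≤k k≤N+2
... | new₁ rewrite ins-new₁ i p | ins-new₁ i q = refl
... | new₂ rewrite ins-new₂ i p | ins-new₂ i q = refl
... | old x 1≤x x≤N rewrite ins-shift i p x | ins-shift i q x = cong (shift i) (p≈q x 1≤x x≤N)

involutive : ∀ {N p x} → IsMatching N p → 1 ≤ x → x ≤ N → p (p x) ≡ x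
involutive mp 1≤x x≤N = proj₂ (proj₂ (mp _ 1≤x x≤N))

partner-sym : ∀ {N p x y} → IsMatching N p → 1 ≤ x → x ≤ N → p x ≡ y → p y ≡ x
partner-sym {p = p} mp 1≤x x≤N px≡y = ≡-trans (cong p (sym px≡y)) (involutive mp 1≤x x≤N)

ins-adjacent-agree : ∀ {M s b k} → IsMatching M s → 1 ≤ b → b ≤ M →
  1 ≤ k → k ≤ M + 2 → k ≢ b → k ≢ suc b → k ≢ suc (suc b) → k ≢ shift b (s b) →
  ins b s k ≡ ins (suc b) s k
ins-adjacent-agree {M} {s} {b} ms 1≤b b≤M 1≤k k≤M+2 k≢b k≢1+b k≢2+b k≢j
  with insView 1≤b (m≤n⇒m≤n+o 1 b≤M) 1≤k k≤M+2
... | new₁ = ⊥-elim (k≢b refl)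
... | new₂ = ⊥-elim (k≢1+b refl)
... | old x 1≤x x≤M = begin
  ins b s (shift b x)               ≡⟨ ins-shift b s x ⟩
  shift b (s x)                     ≡⟨ shift-suc sx≢b ⟩
  shift (suc b) (s x)               ≡⟨ ins-shift (suc b) s x ⟨
  ins (suc b) s (shift (suc b) x)   ≡⟨ cong (ins (suc b) s) (shift-suc x≢b) ⟨
  ins (suc b) s (shift b x)         ∎
  where
  open ≡-Reasoning
  x≢b : x ≢ b
  x≢b refl = k≢2+b (shift-≥ ≤-refl)
  sx≢b : s x ≢ b
  sx≢b sx≡b = k≢j (cong (shift b) (sym (partner-sym ms 1≤x x≤M sx≡b)))

-- Move (a) if b is unmatched in s, otherwise move (b) with j the shifted partner of b.
ins-adjacent-elem : ∀ {M s b} → IsMatching M s → 1 ≤ b → b ≤ M →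
  Elem (M + 2) (ins b s) (ins (suc b) s)
ins-adjacent-elem {M} {s} {b} ms 1≤b b≤M with s b ≟ b
... | yes sb≡b =
  moveA b 1≤b (m≤n⇒2+m≤n+2 b≤M) (ins-new₁ b s) (ins-new₂ b s)
    (≡-trans (ins-≥ s ≤-refl) (≡-trans (cong (shift b) sb≡b) (shift-≥ ≤-refl)))
    (≡-trans (ins-< s (n<1+n b)) (≡-trans (cong (shift (suc b)) sb≡b) (shift-< (n<1+n b))))
    (ins-new₁ (suc b) s) (ins-new₂ (suc b) s)
    (λ k 1≤k k≤ k≢b k≢1+b k≢2+b → ins-adjacent-agree ms 1≤b b≤M 1≤k k≤ k≢b k≢1+b k≢2+b
      (λ k≡j → k≢2+b (≡-trans k≡j (≡-trans (cong (shift b) sb≡b) (shift-≥ ≤-refl)))))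
... | no sb≢b =
  let (1≤c , c≤M , scc) = ms b 1≤b b≤M
      c = s b
      (1≤j , j≤M+2) = shift-∈ (m≤n⇒m≤n+o 1 b≤M) 1≤c c≤M
  in moveB b (shift b c) 1≤b (m≤n⇒2+m≤n+2 b≤M) 1≤j j≤M+2
       (shift≢ b c) (shift≢suc b c) (shift≢2+ sb≢b)
       (ins-new₁ b s) (ins-new₂ b s) (ins-≥ s ≤-refl)
       (≡-trans (ins-shift b s c) (≡-trans (cong (shift b) scc) (shift-≥ ≤-refl)))
       (≡-trans (ins-< s (n<1+n b)) (sym (shift-suc sb≢b)))
       (≡-trans (cong (ins (suc b) s) (shift-suc sb≢b))
         (≡-trans (ins-shift (suc b) s c) (≡-trans (cong (shift (suc b)) scc) (shift-< (n<1+n b)))))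
       (ins-new₁ (suc b) s) (ins-new₂ (suc b) s)
       (λ k 1≤k k≤ k≢b k≢1+b k≢2+b k≢j → ins-adjacent-agree ms 1≤b b≤M 1≤k k≤ k≢b k≢1+b k≢2+b k≢j)

ins-knuthEq-+ : ∀ {M s} → IsMatching M s → ∀ d b → 1 ≤ b → d + b ≤ M + 1 →
  KnuthEq (M + 2) (ins b s) (ins (d + b) s)
ins-knuthEq-+ ms zero b 1≤b b≤M+1 =
  same (ins-isMatching ms 1≤b b≤M+1) (ins-isMatching ms 1≤b b≤M+1) (λ _ _ _ → refl)
ins-knuthEq-+ {M} ms (suc d) b 1≤b 1+d+b≤M+1 =
  trans (ins-knuthEq-+ ms d b 1≤b d+b≤M+1)
        (step (ins-isMatching ms 1≤d+b d+b≤M+1) (ins-isMatching ms (s≤s z≤n) 1+d+b≤M+1)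
              (ins-adjacent-elem ms 1≤d+b (m<n+1⇒m≤n 1+d+b≤M+1)))
  where
  d+b≤M+1 : d + b ≤ M + 1
  d+b≤M+1 = ≤-trans (n≤1+n _) 1+d+b≤M+1
  1≤d+b : 1 ≤ d + b
  1≤d+b = ≤-trans 1≤b (m≤n+m b d)

ins-knuthEq-position : ∀ {M s b c} → IsMatching M s → 1 ≤ b → b ≤ M + 1 → 1 ≤ c → c ≤ M + 1 →
  KnuthEq (M + 2) (ins b s) (ins c s)
ins-knuthEq-position {M} {s} {b} {c} ms 1≤b b≤M+1 1≤c c≤M+1 with ≤-total b c
... | inj₁ b≤c = subst (λ z → KnuthEq (M + 2) (ins b s) (ins z s)) (m∸n+n≡m b≤c)
                   (ins-knuthEq-+ ms (c ∸ b) b 1≤b (subst (_≤ M + 1) (sym (m∸n+n≡m b≤c)) c≤M+1))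
... | inj₂ c≤b = symm (subst (λ z → KnuthEq (M + 2) (ins c s) (ins z s)) (m∸n+n≡m c≤b)
                   (ins-knuthEq-+ ms (b ∸ c) c 1≤c (subst (_≤ M + 1) (sym (m∸n+n≡m c≤b)) b≤M+1)))

ins-ins-adjacent-knuthEq : ∀ {M r a i} → IsMatching M r → 1 ≤ a → a ≤ M → 1 ≤ i → i ≤ (M + 2) + 1 →
  KnuthEq ((M + 2) + 2) (ins i (ins a r)) (ins i (ins (suc a) r))
ins-ins-adjacent-knuthEq {M} {r} {a} {i} mr 1≤a a≤M 1≤i i≤M+3 =
  trans (ins-knuthEq-position mX 1≤i i≤M+3 1≤a a≤M+3)
  (trans (same (ins-isMatching mX 1≤a a≤M+3) (ins-isMatching mX (s≤s z≤n) 2+a≤M+3)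
               (λ k _ _ → ins-ins r k ≤-refl))
  (trans (ins-knuthEq-position mX (s≤s z≤n) 2+a≤M+3 (s≤s z≤n) 3+a≤M+3)
  (trans (same (ins-isMatching mX (s≤s z≤n) 3+a≤M+3) (ins-isMatching mY 1≤a a≤M+3)
               (λ k _ _ → sym (ins-ins r k (n≤1+n a))))
         (ins-knuthEq-position mY 1≤a a≤M+3 1≤i i≤M+3))))
  where
  mX : IsMatching (M + 2) (ins a r)
  mX = ins-isMatching mr 1≤a (m≤n⇒m≤n+o 1 a≤M)
  mY : IsMatching (M + 2) (ins (suc a) r)
  mY = ins-isMatching mr (s≤s z≤n) (m≤n⇒1+m≤n+1 a≤M)
  3+a≤M+3 : suc (suc (suc a)) ≤ (M + 2) + 1
  3+a≤M+3 rewrite +-assoc M 2 1 | +-comm M 3 = s≤s (s≤s (s≤s a≤M))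
  2+a≤M+3 : suc (suc a) ≤ (M + 2) + 1
  2+a≤M+3 = ≤-trans (n≤1+n _) 3+a≤M+3
  a≤M+3 : a ≤ (M + 2) + 1
  a≤M+3 = ≤-trans (n≤1+n _) (≤-trans (n≤1+n _) 2+a≤M+3)

-- remove a p deletes the chord (a, a+1) of p, if present; ins a undoes it.
unshift : ℕ → ℕ → ℕ
unshift a x = if x <ᵇ a then x else x ∸ 2

remove : ℕ → (ℕ → ℕ) → (ℕ → ℕ)
remove a p k = unshift a (p (shift a k))

unshift-shift : ∀ a k → unshift a (shift a k) ≡ k
unshift-shift a k with k <? a
... | yes k<a rewrite shift-< k<a | <ᵇ-true k<a = refl
... | no  k≮a rewrite shift-≥ (≮⇒≥ k≮a) | <ᵇ-false {suc (suc k)} {a} (m≤n⇒m≤2+n (≮⇒≥ k≮a)) = refl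

shift-unshift : ∀ {a x} → x ≢ a → x ≢ suc a → shift a (unshift a x) ≡ x
shift-unshift {a} {x} x≢a x≢1+a with around a x
... | below x<a rewrite <ᵇ-true x<a = shift-< x<a
... | at = ⊥-elim (x≢a refl)
... | next = ⊥-elim (x≢1+a refl)
... | beyond {m} a≤m rewrite <ᵇ-false {suc (suc m)} {a} (m≤n⇒m≤2+n a≤m) = shift-≥ a≤m

unshift-∈ : ∀ {M a y} → 1 ≤ a → a ≤ M + 1 → 1 ≤ y → y ≤ M + 2 → y ≢ a → y ≢ suc a →
  (1 ≤ unshift a y) × (unshift a y ≤ M)
unshift-∈ {M} {a} {y} 1≤a a≤M+1 1≤y y≤M+2 y≢a y≢1+a with around a y
... | below y<a rewrite <ᵇ-true y<a = 1≤y , m<n+1⇒m≤n (<-≤-trans y<a a≤M+1)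
... | at = ⊥-elim (y≢a refl)
... | next = ⊥-elim (y≢1+a refl)
... | beyond {m} a≤m rewrite <ᵇ-false {suc (suc m)} {a} (m≤n⇒m≤2+n a≤m) =
  ≤-trans 1≤a a≤m , 2+m≤n+2⇒m≤n y≤M+2

partner-avoids-chord : ∀ {N p a k} → IsMatching N p → 1 ≤ a → a ≤ N → p a ≡ suc a →
  1 ≤ k → k ≤ N → k ≢ a → k ≢ suc a → (p k ≢ a) × (p k ≢ suc a)
partner-avoids-chord {p = p} mp 1≤a a≤N pa≡1+a 1≤k k≤N k≢a k≢1+a =
  (λ pk≡a → k≢1+a (≡-trans (sym (partner-sym mp 1≤k k≤N pk≡a)) pa≡1+a))
  , (λ pk≡1+a → k≢a (≡-trans (sym (partner-sym mp 1≤k k≤N pk≡1+a)) (partner-sym mp 1≤a a≤N pa≡1+a)))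

remove-isMatching : ∀ {M p a} → IsMatching (M + 2) p → 1 ≤ a → a ≤ M + 1 → p a ≡ suc a →
  IsMatching M (remove a p)
remove-isMatching {M} {p} {a} mp 1≤a a≤M+1 pa≡1+a k 1≤k k≤M =
  let K = shift a k
      (1≤K , K≤M+2) = shift-∈ a≤M+1 1≤k k≤M
      (1≤pK , pK≤M+2 , _) = mp K 1≤K K≤M+2
      (pK≢a , pK≢1+a) = partner-avoids-chord mp 1≤a (m≤n+1⇒m≤n+2 a≤M+1) pa≡1+a
                          1≤K K≤M+2 (shift≢ a k) (shift≢suc a k)
      (1≤r , r≤M) = unshift-∈ 1≤a a≤M+1 1≤pK pK≤M+2 pK≢a pK≢1+a
  in 1≤r , r≤M , (begin
    unshift a (p (shift a (unshift a (p K)))) ≡⟨ cong (unshift a ∘ p) (shift-unshift pK≢a pK≢1+a) ⟩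
    unshift a (p (p K))                       ≡⟨ cong (unshift a) (involutive mp 1≤K K≤M+2) ⟩
    unshift a K                               ≡⟨ unshift-shift a k ⟩
    k                                         ∎)
  where open ≡-Reasoning

ins-remove : ∀ {M p a} → IsMatching (M + 2) p → 1 ≤ a → a ≤ M + 1 → p a ≡ suc a →
  Agree (M + 2) p (ins a (remove a p))
ins-remove {M} {p} {a} mp 1≤a a≤M+1 pa≡1+a k 1≤k k≤M+2 with insView 1≤a a≤M+1 1≤k k≤M+2
... | new₁ = ≡-trans pa≡1+a (sym (ins-new₁ a (remove a p)))
... | new₂ = ≡-trans (partner-sym mp 1≤a (m≤n+1⇒m≤n+2 a≤M+1) pa≡1+a) (sym (ins-new₂ a (remove a p)))
... | old x 1≤x x≤M =
  let (pk≢a , pk≢1+a) = partner-avoids-chord mp 1≤a (m≤n+1⇒m≤n+2 a≤M+1) pa≡1+a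
                          1≤k k≤M+2 (shift≢ a x) (shift≢suc a x)
  in sym (≡-trans (ins-shift a (remove a p) x) (shift-unshift pk≢a pk≢1+a))

-- Relabelling of [N] that moves the gap at {a, a+1} to {a+1, a+2}.
moveGap : ℕ → ℕ → ℕ
moveGap a x = shift (suc a) (unshift a x)

moveGap-id : ∀ {a x} → x ≢ a → x ≢ suc a → x ≢ suc (suc a) → moveGap a x ≡ x
moveGap-id {a} {x} x≢a x≢1+a x≢2+a with around a x
... | below x<a rewrite <ᵇ-true x<a = shift-< (m≤n⇒m≤1+n x<a)
... | at = ⊥-elim (x≢a refl)
... | next = ⊥-elim (x≢1+a refl)
... | beyond {m} a≤m rewrite <ᵇ-false {suc (suc m)} {a} (m≤n⇒m≤2+n a≤m) =
  shift-≥ (≤∧≢⇒< a≤m (λ a≡m → x≢2+a (cong (suc ∘ suc) (sym a≡m))))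

moveGap-2+ : ∀ a → moveGap a (suc (suc a)) ≡ a
moveGap-2+ a rewrite <ᵇ-false {suc (suc a)} {a} (m≤n⇒m≤2+n ≤-refl) = shift-< (n<1+n a)

-- Common shape of moves (a) and (b): the partner of a+2 (itself in move (a))
-- becomes the partner of a, and all other chords are relabelled by moveGap a.
record ChordSlide (N : ℕ) (p q : ℕ → ℕ) : Set where
  field
    a       : ℕ
    1≤a     : 1 ≤ a
    2+a≤N   : suc (suc a) ≤ N
    pa≡1+a  : p a ≡ suc a
    q≡p     : ∀ k → 1 ≤ k → k ≤ N → k ≢ a → k ≢ suc a → k ≢ suc (suc a) → q k ≡ moveGap a (p k)
    qa      : q a ≡ moveGap a (p (suc (suc a)))
    q[1+a]  : q (suc a) ≡ suc (suc a)
    q[2+a]  : q (suc (suc a)) ≡ suc a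

moveGap-partner : ∀ {N p a k} → IsMatching N p → 1 ≤ a → suc (suc a) ≤ N → p a ≡ suc a →
  1 ≤ k → k ≤ N → k ≢ a → k ≢ suc a → p k ≢ suc (suc a) → moveGap a (p k) ≡ p k
moveGap-partner mp 1≤a 2+a≤N pa≡1+a 1≤k k≤N k≢a k≢1+a pk≢2+a =
  let (pk≢a , pk≢1+a) = partner-avoids-chord mp 1≤a (≤-trans (m≤n⇒m≤2+n ≤-refl) 2+a≤N) pa≡1+a
                          1≤k k≤N k≢a k≢1+a
  in moveGap-id pk≢a pk≢1+a pk≢2+a

elem⇒chordSlide : ∀ {N p q} → IsMatching N p → Elem N p q → ChordSlide N p q
elem⇒chordSlide mp (moveA a 1≤a 2+a≤N pa _ p[2+a] qa q[1+a] q[2+a] q≈p) = record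
  { a = a ; 1≤a = 1≤a ; 2+a≤N = 2+a≤N ; pa≡1+a = pa
  ; q≡p = λ k 1≤k k≤N k≢a k≢1+a k≢2+a →
      let pk≢2+a = λ pk≡2+a → k≢2+a (≡-trans (sym (partner-sym mp 1≤k k≤N pk≡2+a)) p[2+a])
      in ≡-trans (sym (q≈p k 1≤k k≤N k≢a k≢1+a k≢2+a))
                 (sym (moveGap-partner mp 1≤a 2+a≤N pa 1≤k k≤N k≢a k≢1+a pk≢2+a))
  ; qa = ≡-trans qa (sym (≡-trans (cong (moveGap a) p[2+a]) (moveGap-2+ a)))
  ; q[1+a] = q[1+a] ; q[2+a] = q[2+a] }
elem⇒chordSlide {N} {p} {q} mp
  (moveB a j 1≤a 2+a≤N _ _ j≢a j≢1+a j≢2+a pa _ p[2+a] pj qa qj q[1+a] q[2+a] q≈p) = record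
  { a = a ; 1≤a = 1≤a ; 2+a≤N = 2+a≤N ; pa≡1+a = pa
  ; q≡p = q≡p
  ; qa = ≡-trans qa (sym (≡-trans (cong (moveGap a) p[2+a]) (moveGap-id j≢a j≢1+a j≢2+a)))
  ; q[1+a] = q[1+a] ; q[2+a] = q[2+a] }
  where
  q≡p : ∀ k → 1 ≤ k → k ≤ N → k ≢ a → k ≢ suc a → k ≢ suc (suc a) → q k ≡ moveGap a (p k)
  q≡p k 1≤k k≤N k≢a k≢1+a k≢2+a with k ≟ j
  ... | yes refl = ≡-trans qj (sym (≡-trans (cong (moveGap a) pj) (moveGap-2+ a)))
  ... | no k≢j =
    let pk≢2+a = λ pk≡2+a → k≢j (≡-trans (sym (partner-sym mp 1≤k k≤N pk≡2+a)) p[2+a])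
    in ≡-trans (sym (q≈p k 1≤k k≤N k≢a k≢1+a k≢2+a k≢j))
               (sym (moveGap-partner mp 1≤a 2+a≤N pa 1≤k k≤N k≢a k≢1+a pk≢2+a))

module _ {M p q} (mp : IsMatching (M + 2) p) (slide : ChordSlide (M + 2) p q) where
  open ChordSlide slide

  private
    a≤M : a ≤ M
    a≤M = 2+m≤n+2⇒m≤n 2+a≤N

    a≤M+1 : a ≤ M + 1
    a≤M+1 = m≤n⇒m≤n+o 1 a≤M

    r : ℕ → ℕ
    r = remove a p

    mr : IsMatching M r
    mr = remove-isMatching mp 1≤a a≤M+1 pa≡1+a

  chordSlide-ins-remove : Agree (M + 2) q (ins (suc a) r)
  chordSlide-ins-remove k 1≤k k≤M+2 with insView (s≤s z≤n) (m≤n⇒1+m≤n+1 a≤M) 1≤k k≤M+2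
  ... | new₁ = ≡-trans q[1+a] (sym (ins-new₁ (suc a) r))
  ... | new₂ = ≡-trans q[2+a] (sym (ins-new₂ (suc a) r))
  ... | old x 1≤x x≤M with x ≟ a
  ...   | yes refl rewrite shift-< (n<1+n a) | ins-< r (n<1+n a) | shift-≥ {a} {a} ≤-refl = qa
  ...   | no x≢a rewrite ins-shift (suc a) r x | shift-suc x≢a =
    q≡p (shift (suc a) x) 1≤k k≤M+2 (shift-suc≢ x≢a) (shift≢ (suc a) x) (shift≢suc (suc a) x)

  ins-knuthEq-chordSlide : ∀ {i} → IsMatching (M + 2) q → 1 ≤ i → i ≤ (M + 2) + 1 →
    KnuthEq ((M + 2) + 2) (ins i p) (ins i q)
  ins-knuthEq-chordSlide mq 1≤i i≤M+3 =
    trans (same (ins-isMatching mp 1≤i i≤M+3) (ins-isMatching mX 1≤i i≤M+3)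
                (ins-agree 1≤i i≤M+3 (ins-remove mp 1≤a a≤M+1 pa≡1+a)))
    (trans (ins-ins-adjacent-knuthEq mr 1≤a a≤M 1≤i i≤M+3)
           (same (ins-isMatching mY 1≤i i≤M+3) (ins-isMatching mq 1≤i i≤M+3)
                 (ins-agree 1≤i i≤M+3 (λ k 1≤k k≤M+2 → sym (chordSlide-ins-remove k 1≤k k≤M+2)))))
    where
    mX : IsMatching (M + 2) (ins a r)
    mX = ins-isMatching mr 1≤a a≤M+1
    mY : IsMatching (M + 2) (ins (suc a) r)
    mY = ins-isMatching mr (s≤s z≤n) (m≤n⇒1+m≤n+1 a≤M)

elem-size : ∀ {N p q} → Elem N p q → ∃[ M ] N ≡ M + 2
elem-size {N} (moveA _ _ 2+a≤N _ _ _ _ _ _ _) = N ∸ 2 , sym (m∸n+n≡m (≤-trans (s≤s (s≤s z≤n)) 2+a≤N))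
elem-size {N} (moveB _ _ _ 2+a≤N _ _ _ _ _ _ _ _ _ _ _ _ _ _) =
  N ∸ 2 , sym (m∸n+n≡m (≤-trans (s≤s (s≤s z≤n)) 2+a≤N))

ins-knuthEq : ∀ {N p q i} → 1 ≤ i → i ≤ N + 1 → KnuthEq N p q → KnuthEq (N + 2) (ins i p) (ins i q)
ins-knuthEq 1≤i i≤N+1 (same mp mq p≈q) =
  same (ins-isMatching mp 1≤i i≤N+1) (ins-isMatching mq 1≤i i≤N+1) (ins-agree 1≤i i≤N+1 p≈q)
ins-knuthEq 1≤i i≤N+1 (step mp mq e) with elem-size e
... | _ , refl = ins-knuthEq-chordSlide mp (elem⇒chordSlide mp e) mq 1≤i i≤N+1
ins-knuthEq 1≤i i≤N+1 (symm p~q) = symm (ins-knuthEq 1≤i i≤N+1 p~q)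
ins-knuthEq 1≤i i≤N+1 (trans p~q q~r) = trans (ins-knuthEq 1≤i i≤N+1 p~q) (ins-knuthEq 1≤i i≤N+1 q~r)

lemma5p7 : (N : ℕ) (m₁ m₂ : ℕ → ℕ) (i : ℕ) →
    IsMatching N m₁ → IsMatching N m₂ → KnuthEq N m₁ m₂ →
    1 ≤ i → i ≤ N + 1 →
    KnuthEq (N + 2) (ins i m₁) (ins i m₂)
lemma5p7 N m₁ m₂ i _ _ m₁~m₂ 1≤i i≤N+1 = ins-knuthEq 1≤i i≤N+1 m₁~m₂
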